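{- For all integers $n\ge r\ge 2$, $$ \sum_{\substack{j_1+\cdots+j_r=n\\ j_1,\dots,j_r\ge 1}}B_{j_1}\cdots B_{j_r} =\sum_{m=0}^{\lfloor (n-r+1)/2\rfloor}\binom{n-m-1}{r-2}\binom{m+r-2}{r-2}\frac{n-2 m-r+1}{r-1}B_{n-2 m-r+1}\,. $$
   Context: The balancing numbers $B_n$ are defined by $B_0=0$, $B_1=1$ and $B_n=6B_{n-1}-B_{n-2}$ for $n\ge 2$. The sum on the left is over ordered $r$-tuples of positive integers summing to $n$. -}

module Defs where

open import Data.Nat using (ℕ; zero; suc; _+_; _*_; _∸_) renaming (_/_ to _div_)
open import Data.List using (List; []; _∷_; map; concatMap; sum; upTo)
open import Data.Vec using (Vec; []; _∷_; foldr)
import Data.Integer as ℤ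
open import Data.Rational using (ℚ) renaming (_+_ to _+ℚ_; _*_ to _*ℚ_)
import Data.Rational as ℚ

B : ℕ → ℤ.ℤ
B zero = ℤ.+ 0
B (suc zero) = ℤ.+ 1
B (suc (suc n)) = (ℤ.+ 6) ℤ.* B (suc n) ℤ.- B n

compositions : (r n : ℕ) → List (Vec ℕ r)
compositions zero zero = [] ∷ []
compositions zero (suc n) = []
compositions (suc r) n =
  concatMap (λ i → map (λ v → suc i ∷ v) (compositions r (n ∸ suc i))) (upTo n)

prodB : ∀ {r} → Vec ℕ r → ℤ.ℤ
prodB = foldr _ (λ j acc → B j ℤ.* acc) (ℤ.+ 1)

sumℤ : List ℤ.ℤ → ℤ.ℤ
sumℤ = Data.List.foldr ℤ._+_ (ℤ.+ 0)

sumℚ : List ℚ → ℚ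
sumℚ = Data.List.foldr _+ℚ_ ℚ.0ℚ

lhs : ℕ → ℕ → ℤ.ℤ
lhs r n = sumℤ (map prodB (compositions r n))

open import Data.Nat.Combinatorics using (_C_)

-- Summand of the right-hand side, for r ≥ 2 (with k = r - 2):
--   C(n-m-1, r-2) · C(m+r-2, r-2) · (n-2m-r+1)/(r-1) · B_{n-2m-r+1}
-- For m ≤ ⌊(n-r+1)/2⌋ all ℕ-subtractions below are exact.
rhsTerm : (r n m : ℕ) → ℚ
rhsTerm zero n m = ℚ.0ℚ
rhsTerm (suc zero) n m = ℚ.0ℚ
rhsTerm r@(suc (suc k)) n m =
  let e = n ∸ 2 * m ∸ (r ∸ 1) in
  ((ℤ.+ (((n ∸ m ∸ 1) C k) * ((m + k) C k) * e)) ℤ.* B e) ℚ./ (suc k)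

rhs : ℕ → ℕ → ℚ
rhs r n = sumℚ (map (rhsTerm r n) (upTo (suc ((n ∸ (r ∸ 1)) div 2))))

module Submission where

-- Let conv r n be the left-hand side, the coefficient of xⁿ in B(x)ʳ where
-- B(x) = Σ Bⱼ xʲ = x / (1 − 6x + x²).  Two facts about these coefficients
-- drive the proof:
--   * (1 − 6x + x²)·Bʳ⁺¹ = x·Bʳ, i.e. conv (r+1) satisfies the balancing
--     recurrence forced by conv r  (conv-recurrence);
--   * B' = B²(1 − x²)/x², hence (Bʳ)' = r·Bʳ⁺¹(x⁻² − 1), i.e.
--     (n+1)·conv r (n+1) = r·(conv (r+1) (n+2) − conv (r+1) n)  (derivative-identity).
-- The second follows from the first by induction on r, since its defect obeys
-- the balancing recurrence forced by the defect one level down.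
-- Writing T k n for (k+1) times the right-hand side with r = k + 2, a binomial
-- identity (binomial-step) gives (k+1)·(T (k+1) (n+2) − T (k+1) n) = (n+1)·T k (n+1),
-- which is the derivative identity transported through conv (k+2) = T k / (k+1).
-- Hence (k+1)·conv (k+2) n = T k n by induction on k, comparing second differences
-- in n (closed-form).  Finally the theorem divides by k+1 in ℚ and cuts the sum
-- defining T at ⌊(n−k−1)/2⌋, beyond which all summands vanish.

open import Defs
open import Data.Nat using (ℕ; _≤_)
open import Data.Rational using (ℚ)
import Data.Rational as ℚ
open import Relation.Binary.PropositionalEquality using (_≡_)

open import Data.Nat as ℕ using (zero; suc; _∸_; _<_; z≤n; s≤s)
import Data.Nat.Properties as ℕP
open import Data.List using (List; []; _∷_; _++_; map; concatMap; upTo; applyUpTo)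
open import Data.List.Properties using (map-++)
open import Data.Vec using (Vec) renaming (_∷_ to _∷ᵥ_)
import Data.Rational.Properties as ℚP
import Data.Rational.Unnormalised as ℚᵘ
import Data.Rational.Unnormalised.Properties as ℚᵘP
open import Relation.Binary.PropositionalEquality
  using (refl; sym; trans; cong; cong₂; subst; module ≡-Reasoning)
open ≡-Reasoning

module NatFacts where

  open import Data.Nat using (_+_; _*_; _/_; _%_)
  open import Data.Nat.Properties
  open import Data.Nat.Combinatorics using (_C_; nCk+nC[k+1]≡[n+1]C[k+1]; k>n⇒nCk≡0; nC1≡n)
  open import Data.Nat.DivMod using (m≡m%n+[m/n]*n; m%n<n)
  open import Data.Nat.Tactic.RingSolver using (solve-∀)

  pascal : ∀ n k → suc n C suc k ≡ n C k + n C suc k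
  pascal n k = sym (nCk+nC[k+1]≡[n+1]C[k+1] n k)

  absorption : ∀ N k → suc k * (suc N C suc k) ≡ suc N * (N C k)
  absorption zero    zero    = refl
  absorption zero    (suc k) =
    trans (cong (suc (suc k) *_) (k>n⇒nCk≡0 {1} {suc (suc k)} (s≤s (s≤s z≤n)))) (*-zeroʳ (suc (suc k)))
  absorption (suc N) zero    =
    trans (+-identityʳ _) (trans (nC1≡n (suc (suc N))) (sym (*-identityʳ (suc (suc N)))))
  absorption (suc N) (suc k) = begin
    suc (suc k) * (suc (suc N) C suc (suc k))
      ≡⟨ cong (suc (suc k) *_) (pascal (suc N) (suc k)) ⟩
    suc (suc k) * (a + b)
      ≡⟨ split a b k ⟩
    suc k * a + a + suc (suc k) * b
      ≡⟨ cong₂ (λ x y → x + a + y) (absorption N k) (absorption N (suc k)) ⟩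
    suc N * (N C k) + a + suc N * (N C suc k)
      ≡⟨ regroup (N C k) (N C suc k) a N ⟩
    suc N * (N C k + N C suc k) + a
      ≡⟨ cong (λ x → suc N * x + a) (sym (pascal N k)) ⟩
    suc N * a + a
      ≡⟨ +-comm (suc N * a) a ⟩
    suc (suc N) * a ∎
    where
    a = suc N C suc k
    b = suc N C suc (suc k)
    split : ∀ a b k → suc (suc k) * (a + b) ≡ suc k * a + a + suc (suc k) * b
    split = solve-∀
    regroup : ∀ x y a N → suc N * x + a + suc N * y ≡ suc N * (x + y) + a
    regroup = solve-∀

  absorption-pascal : ∀ N k → suc k * (N C suc k) + suc k * (N C k) ≡ suc N * (N C k)
  absorption-pascal N k = begin
    suc k * (N C suc k) + suc k * (N C k) ≡⟨ sym (*-distribˡ-+ (suc k) (N C suc k) (N C k)) ⟩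
    suc k * (N C suc k + N C k)           ≡⟨ cong (suc k *_) (+-comm (N C suc k) (N C k)) ⟩
    suc k * (N C k + N C suc k)           ≡⟨ cong (suc k *_) (sym (pascal N k)) ⟩
    suc k * (suc N C suc k)               ≡⟨ absorption N k ⟩
    suc N * (N C k) ∎

  -- Expanding the left side by Pascal and adding 2(k+1)·C(N,k)·C(m+k,k) to
  -- both sides turns it into two instances of absorption-pascal.
  binomial-step : ∀ N m k →
    suc k * ((suc N C suc k) * (suc (m + k) C suc k)) ≡
    suc k * ((N C suc k) * ((m + k) C suc k)) + suc (N + m) * ((N C k) * ((m + k) C k))
  binomial-step N m k = +-cancelʳ-≡ (2 * (suc k * (a * b))) _ _ (begin
    suc k * ((suc N C suc k) * (suc (m + k) C suc k)) + 2 * (suc k * (a * b))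
      ≡⟨ cong₂ (λ x y → suc k * (x * y) + 2 * (suc k * (a * b))) (pascal N k) (pascal (m + k) k) ⟩
    suc k * ((a + a′) * (b + b′)) + 2 * (suc k * (a * b))
      ≡⟨ expand a a′ b b′ k ⟩
    suc k * (a * b) + a * (suc k * b′ + suc k * b) + b * (suc k * a′ + suc k * a) + suc k * (a′ * b′)
      ≡⟨ cong₂ (λ x y → suc k * (a * b) + a * x + b * y + suc k * (a′ * b′))
               (absorption-pascal (m + k) k) (absorption-pascal N k) ⟩
    suc k * (a * b) + a * (suc (m + k) * b) + b * (suc N * a) + suc k * (a′ * b′)
      ≡⟨ collect a a′ b b′ k m N ⟩
    suc k * (a′ * b′) + suc (N + m) * (a * b) + 2 * (suc k * (a * b)) ∎)
    where
    a  = N C k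
    a′ = N C suc k
    b  = (m + k) C k
    b′ = (m + k) C suc k
    expand : ∀ a a′ b b′ k →
      suc k * ((a + a′) * (b + b′)) + 2 * (suc k * (a * b)) ≡
      suc k * (a * b) + a * (suc k * b′ + suc k * b) + b * (suc k * a′ + suc k * a) + suc k * (a′ * b′)
    expand = solve-∀
    collect : ∀ a a′ b b′ k m N →
      suc k * (a * b) + a * (suc (m + k) * b) + b * (suc N * a) + suc k * (a′ * b′) ≡
      suc k * (a′ * b′) + suc (N + m) * (a * b) + 2 * (suc k * (a * b))
    collect = solve-∀

  coefficient-step : ∀ k n m → m ≤ n →
    suc k * (((suc (suc n) ∸ m ∸ 1) C suc k) * ((m + suc k) C suc k)) ≡
    suc k * (((n ∸ m) C suc k) * ((m + k) C suc k)) + suc n * (((suc n ∸ m ∸ 1) C k) * ((m + k) C k))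
  coefficient-step k n m m≤n
    rewrite +-∸-assoc 2 m≤n | +-∸-assoc 1 m≤n | +-suc m k =
    trans (binomial-step (n ∸ m) m k) (cong (λ z → rest + suc z * c₀) (m∸n+n≡m m≤n))
    where
    rest = suc k * (((n ∸ m) C suc k) * ((m + k) C suc k))
    c₀   = ((n ∸ m) C k) * ((m + k) C k)

  ∸-suc-suc : ∀ a b d → suc a ∸ b ∸ suc d ≡ a ∸ b ∸ d
  ∸-suc-suc a b d = begin
    suc a ∸ b ∸ suc d   ≡⟨ ∸-+-assoc (suc a) b (suc d) ⟩
    suc a ∸ (b + suc d) ≡⟨ cong (suc a ∸_) (+-suc b d) ⟩
    a ∸ (b + d)         ≡⟨ sym (∸-+-assoc a b d) ⟩
    a ∸ b ∸ d ∎

  exponent-zero : ∀ n m k → n ∸ suc k ≤ 2 * m → n ∸ 2 * m ∸ suc k ≡ 0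
  exponent-zero n m k bound = begin
    n ∸ 2 * m ∸ suc k   ≡⟨ ∸-+-assoc n (2 * m) (suc k) ⟩
    n ∸ (2 * m + suc k) ≡⟨ cong (n ∸_) (+-comm (2 * m) (suc k)) ⟩
    n ∸ (suc k + 2 * m) ≡⟨ sym (∸-+-assoc n (suc k) (2 * m)) ⟩
    n ∸ suc k ∸ 2 * m   ≡⟨ m≤n⇒m∸n≡0 bound ⟩
    0 ∎

  -- A positive exponent n − 2m − k forces m ≤ n, where the coefficients are exact.
  positive-exponent⇒m≤n : ∀ n m k → 0 < n ∸ 2 * m ∸ k → m ≤ n
  positive-exponent⇒m≤n n m k pos = ≮⇒≥ λ n<m → n≮n 0 (subst (0 <_) (exponent-vanishes n<m) pos)
    where
    exponent-vanishes : n < m → n ∸ 2 * m ∸ k ≡ 0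
    exponent-vanishes n<m = trans (cong (_∸ k) (m≤n⇒m∸n≡0 (≤-trans (<⇒≤ n<m) (m≤m+n m (m + 0)))))
                                  (0∸n≡0 k)

  half-bound : ∀ x → x < 2 * suc (x / 2)
  half-bound x =
    subst (x <_) (rearrange (x / 2))
      (subst (_< 2 + x / 2 * 2) (sym (m≡m%n+[m/n]*n x 2)) (+-monoˡ-< (x / 2 * 2) (m%n<n x 2)))
    where
    rearrange : ∀ q → 2 + q * 2 ≡ 2 * suc q
    rearrange = solve-∀

  beyond-half : ∀ n m k → suc ((n ∸ suc k) / 2) ≤ m → n ∸ suc k ≤ 2 * m
  beyond-half n m k b≤m = <⇒≤ (<-≤-trans (half-bound (n ∸ suc k)) (*-monoʳ-≤ 2 b≤m))

  beyond-range : ∀ n m k → n ≤ m → n ∸ suc k ≤ 2 * m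
  beyond-range n m k n≤m = ≤-trans (m∸n≤m n (suc k)) (≤-trans n≤m (m≤m+n m (m + 0)))

open NatFacts
open import Data.Nat.Combinatorics using (_C_; k>n⇒nCk≡0)
open import Data.Integer using (ℤ; +_; 0ℤ; 1ℤ; -1ℤ; _+_; _*_; _-_)
import Data.Integer.Properties as ℤP
import Data.Nat.Tactic.RingSolver as ℕSolver
open import Data.Integer.Tactic.RingSolver using (solve-∀; solve)

∑ : ℕ → (ℕ → ℤ) → ℤ
∑ zero    f = 0ℤ
∑ (suc n) f = f 0 + ∑ n (λ i → f (suc i))

∑-cong : ∀ n {f g : ℕ → ℤ} → (∀ i → f i ≡ g i) → ∑ n f ≡ ∑ n g
∑-cong zero    f≗g = refl
∑-cong (suc n) f≗g = cong₂ _+_ (f≗g 0) (∑-cong n (λ i → f≗g (suc i)))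

∑-scale : ∀ n (c : ℤ) (f : ℕ → ℤ) → ∑ n (λ i → c * f i) ≡ c * ∑ n f
∑-scale zero    c f = sym (ℤP.*-zeroʳ c)
∑-scale (suc n) c f =
  trans (cong (λ z → c * f 0 + z) (∑-scale n c (λ i → f (suc i))))
        (sym (ℤP.*-distribˡ-+ c (f 0) (∑ n (λ i → f (suc i)))))

∑-linear : ∀ n (a b : ℤ) (f g : ℕ → ℤ) →
           ∑ n (λ i → a * f i + b * g i) ≡ a * ∑ n f + b * ∑ n g
∑-linear zero    a b f g = vanish a b
  where
  vanish : ∀ a b → 0ℤ ≡ a * 0ℤ + b * 0ℤ
  vanish = solve-∀
∑-linear (suc n) a b f g =
  trans (cong (λ z → a * f 0 + b * g 0 + z) (∑-linear n a b (λ i → f (suc i)) (λ i → g (suc i))))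
        (regroup a b (f 0) (g 0) (∑ n (λ i → f (suc i))) (∑ n (λ i → g (suc i))))
  where
  regroup : ∀ a b x y X Y → a * x + b * y + (a * X + b * Y) ≡ a * (x + X) + b * (y + Y)
  regroup = solve-∀

∑-last : ∀ n (f : ℕ → ℤ) → ∑ (suc n) f ≡ ∑ n f + f n
∑-last zero    f = ℤP.+-comm (f 0) 0ℤ
∑-last (suc n) f =
  trans (cong (λ z → f 0 + z) (∑-last n (λ i → f (suc i))))
        (sym (ℤP.+-assoc (f 0) (∑ n (λ i → f (suc i))) (f (suc n))))

∑-truncate : ∀ a d (f : ℕ → ℤ) → (∀ m → a ≤ m → f m ≡ 0ℤ) → ∑ (d ℕ.+ a) f ≡ ∑ a f
∑-truncate a zero    f vanish = refl
∑-truncate a (suc d) f vanish = begin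
  ∑ (suc (d ℕ.+ a)) f          ≡⟨ ∑-last (d ℕ.+ a) f ⟩
  ∑ (d ℕ.+ a) f + f (d ℕ.+ a)
    ≡⟨ cong (λ z → ∑ (d ℕ.+ a) f + z) (vanish (d ℕ.+ a) (ℕP.m≤n+m a d)) ⟩
  ∑ (d ℕ.+ a) f + 0ℤ           ≡⟨ ℤP.+-identityʳ _ ⟩
  ∑ (d ℕ.+ a) f                ≡⟨ ∑-truncate a d f vanish ⟩
  ∑ a f ∎

∑-support : ∀ a b (f : ℕ → ℤ) → (∀ m → a ≤ m → f m ≡ 0ℤ) → (∀ m → b ≤ m → f m ≡ 0ℤ) →
            ∑ a f ≡ ∑ b f
∑-support a b f vanish-a vanish-b = begin
  ∑ a f         ≡⟨ sym (∑-truncate a b f vanish-a) ⟩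
  ∑ (b ℕ.+ a) f ≡⟨ cong (λ c → ∑ c f) (ℕP.+-comm b a) ⟩
  ∑ (a ℕ.+ b) f ≡⟨ ∑-truncate b a f vanish-b ⟩
  ∑ b f ∎

sumℤ-++ : ∀ (xs ys : List ℤ) → sumℤ (xs ++ ys) ≡ sumℤ xs + sumℤ ys
sumℤ-++ []       ys = sym (ℤP.+-identityˡ (sumℤ ys))
sumℤ-++ (x ∷ xs) ys = trans (cong (λ z → x + z) (sumℤ-++ xs ys)) (sym (ℤP.+-assoc x (sumℤ xs) (sumℤ ys)))

sumℤ-concatMap : ∀ {A C : Set} (f : C → ℤ) (g : A → List C) (xs : List A) →
  sumℤ (map f (concatMap g xs)) ≡ sumℤ (map (λ x → sumℤ (map f (g x))) xs)
sumℤ-concatMap f g []       = refl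
sumℤ-concatMap f g (x ∷ xs) = begin
  sumℤ (map f (g x ++ concatMap g xs))
    ≡⟨ cong sumℤ (map-++ f (g x) (concatMap g xs)) ⟩
  sumℤ (map f (g x) ++ map f (concatMap g xs))
    ≡⟨ sumℤ-++ (map f (g x)) (map f (concatMap g xs)) ⟩
  sumℤ (map f (g x)) + sumℤ (map f (concatMap g xs))
    ≡⟨ cong (λ z → sumℤ (map f (g x)) + z) (sumℤ-concatMap f g xs) ⟩
  sumℤ (map f (g x)) + sumℤ (map (λ x → sumℤ (map f (g x))) xs) ∎

sumℤ-applyUpTo : ∀ (f : ℕ → ℤ) (g : ℕ → ℕ) n →
  sumℤ (map f (applyUpTo g n)) ≡ ∑ n (λ i → f (g i))
sumℤ-applyUpTo f g zero    = refl
sumℤ-applyUpTo f g (suc n) = cong (λ z → f (g 0) + z) (sumℤ-applyUpTo f (λ i → g (suc i)) n)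

sumℤ-upTo : ∀ (f : ℕ → ℤ) n → sumℤ (map f (upTo n)) ≡ ∑ n f
sumℤ-upTo f = sumℤ-applyUpTo f (λ i → i)

-- conv r n is the left-hand side, computed by recursion on the first part j₁ = i + 1:
-- the coefficient of xⁿ in B(x)ʳ.
conv : ℕ → ℕ → ℤ
conv zero    zero    = 1ℤ
conv zero    (suc n) = 0ℤ
conv (suc r) n       = ∑ n (λ i → B (suc i) * conv r (n ∸ suc i))

sumℤ-prodB-cons : ∀ {r} j (vs : List (Vec ℕ r)) →
  sumℤ (map prodB (map (λ v → j ∷ᵥ v) vs)) ≡ B j * sumℤ (map prodB vs)
sumℤ-prodB-cons j []       = sym (ℤP.*-zeroʳ (B j))
sumℤ-prodB-cons j (v ∷ vs) =
  trans (cong (λ z → B j * prodB v + z) (sumℤ-prodB-cons j vs))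
        (sym (ℤP.*-distribˡ-+ (B j) (prodB v) (sumℤ (map prodB vs))))

lhs≡conv : ∀ r n → lhs r n ≡ conv r n
lhs≡conv zero    zero    = refl
lhs≡conv zero    (suc n) = refl
lhs≡conv (suc r) n = begin
  sumℤ (map prodB (concatMap parts (upTo n)))
    ≡⟨ sumℤ-concatMap prodB parts (upTo n) ⟩
  sumℤ (map (λ i → sumℤ (map prodB (parts i))) (upTo n))
    ≡⟨ sumℤ-upTo (λ i → sumℤ (map prodB (parts i))) n ⟩
  ∑ n (λ i → sumℤ (map prodB (parts i)))
    ≡⟨ ∑-cong n (λ i → sumℤ-prodB-cons (suc i) (compositions r (n ∸ suc i))) ⟩
  ∑ n (λ i → B (suc i) * lhs r (n ∸ suc i))
    ≡⟨ ∑-cong n (λ i → cong (B (suc i) *_) (lhs≡conv r (n ∸ suc i))) ⟩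
  conv (suc r) n ∎
  where
  parts : ℕ → List (Vec ℕ (suc r))
  parts i = map (λ v → suc i ∷ᵥ v) (compositions r (n ∸ suc i))

-- (1 − 6x + x²)·Bʳ⁺¹ = x·Bʳ: the balancing recurrence, forced by the previous power.
conv-recurrence : ∀ r n →
  conv (suc r) (suc (suc n)) ≡ + 6 * conv (suc r) (suc n) - conv (suc r) n + conv r (suc n)
conv-recurrence r n = begin
  B 1 * conv r (suc n) + ∑ (suc n) (λ i → B (suc (suc i)) * c i)
    ≡⟨ cong₂ _+_ (ℤP.*-identityˡ (conv r (suc n)))
                 (∑-cong (suc n) (λ i → split (B (suc i)) (B i) (c i))) ⟩
  conv r (suc n) + ∑ (suc n) (λ i → + 6 * (B (suc i) * c i) + -1ℤ * (B i * c i))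
    ≡⟨ cong (λ z → conv r (suc n) + z)
            (∑-linear (suc n) (+ 6) -1ℤ (λ i → B (suc i) * c i) (λ i → B i * c i)) ⟩
  conv r (suc n) + (+ 6 * conv (suc r) (suc n) + -1ℤ * (0ℤ + conv (suc r) n))
    ≡⟨ cong (λ z → conv r (suc n) + (+ 6 * conv (suc r) (suc n) + -1ℤ * z))
            (ℤP.+-identityˡ (conv (suc r) n)) ⟩
  conv r (suc n) + (+ 6 * conv (suc r) (suc n) + -1ℤ * conv (suc r) n)
    ≡⟨ reorder (conv r (suc n)) (conv (suc r) (suc n)) (conv (suc r) n) ⟩
  + 6 * conv (suc r) (suc n) - conv (suc r) n + conv r (suc n) ∎
  where
  c : ℕ → ℤ
  c i = conv r (suc n ∸ suc i)
  split : ∀ b₁ b₀ x → (+ 6 * b₁ - b₀) * x ≡ + 6 * (b₁ * x) + -1ℤ * (b₀ * x)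
  split = solve-∀
  reorder : ∀ x y z → x + (+ 6 * y + -1ℤ * z) ≡ + 6 * y - z + x
  reorder = solve-∀

conv-one : ∀ n → conv 1 n ≡ B n
conv-one zero          = refl
conv-one (suc zero)    = refl
conv-one (suc (suc n)) = begin
  conv 1 (suc (suc n))                              ≡⟨ conv-recurrence 0 n ⟩
  + 6 * conv 1 (suc n) - conv 1 n + 0ℤ              ≡⟨ ℤP.+-identityʳ _ ⟩
  + 6 * conv 1 (suc n) - conv 1 n
    ≡⟨ cong₂ (λ x y → + 6 * x - y) (conv-one (suc n)) (conv-one n) ⟩
  B (suc (suc n)) ∎

Δ₂ : (ℕ → ℤ) → ℕ → ℤ
Δ₂ x n = x (suc (suc n)) - x n

Δ₂-scale : ∀ (c : ℤ) (x : ℕ → ℤ) n → Δ₂ (λ i → c * x i) n ≡ c * Δ₂ x n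
Δ₂-scale c x n = factor c (x (suc (suc n))) (x n)
  where
  factor : ∀ c a b → c * a - c * b ≡ c * (a - b)
  factor = solve-∀

Δ₂-determines : ∀ (x y : ℕ → ℤ) → x 0 ≡ y 0 → x 1 ≡ y 1 → (∀ n → Δ₂ x n ≡ Δ₂ y n) →
                ∀ n → x n ≡ y n
Δ₂-determines x y e₀ e₁ eΔ zero          = e₀
Δ₂-determines x y e₀ e₁ eΔ (suc zero)    = e₁
Δ₂-determines x y e₀ e₁ eΔ (suc (suc n)) = begin
  x (suc (suc n))  ≡⟨ recover (x (suc (suc n))) (x n) ⟩
  Δ₂ x n + x n     ≡⟨ cong₂ _+_ (eΔ n) (Δ₂-determines x y e₀ e₁ eΔ n) ⟩
  Δ₂ y n + y n     ≡⟨ sym (recover (y (suc (suc n))) (y n)) ⟩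
  y (suc (suc n)) ∎
  where
  recover : ∀ a b → a ≡ a - b + b
  recover = solve-∀

forced-recurrence-vanishes : ∀ (c d : ℤ) (x y : ℕ → ℤ) →
  (∀ n → x (suc (suc n)) ≡ c * x (suc n) + d * x n + y n) → (∀ n → y n ≡ 0ℤ) →
  x 0 ≡ 0ℤ → x 1 ≡ 0ℤ → ∀ n → x n ≡ 0ℤ
forced-recurrence-vanishes c d x y rec y≡0 x₀ x₁ zero          = x₀
forced-recurrence-vanishes c d x y rec y≡0 x₀ x₁ (suc zero)    = x₁
forced-recurrence-vanishes c d x y rec y≡0 x₀ x₁ (suc (suc n)) = begin
  x (suc (suc n))                     ≡⟨ rec n ⟩
  c * x (suc n) + d * x n + y n
    ≡⟨ cong₂ (λ u v → c * u + d * v + y n) (vanishes (suc n)) (vanishes n) ⟩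
  c * 0ℤ + d * 0ℤ + y n               ≡⟨ cong (λ z → c * 0ℤ + d * 0ℤ + z) (y≡0 n) ⟩
  c * 0ℤ + d * 0ℤ + 0ℤ                ≡⟨ zero-combination c d ⟩
  0ℤ ∎
  where
  vanishes : ∀ n → x n ≡ 0ℤ
  vanishes = forced-recurrence-vanishes c d x y rec y≡0 x₀ x₁
  zero-combination : ∀ c d → c * 0ℤ + d * 0ℤ + 0ℤ ≡ 0ℤ
  zero-combination = solve-∀

derivative-defect : ℕ → ℕ → ℤ
derivative-defect r n = + suc n * conv r (suc n) - + r * Δ₂ (conv (suc r)) n

-- The polynomial identity behind defect-recurrence, with aⱼ = conv (s+2) (j+n),
-- bⱼ = conv (s+1) (j+n), cⱼ = conv s (j+n), after eliminating a₄, a₂, b₃ by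
-- conv-recurrence.
defect-algebra : ∀ (s n a₀ a₁ a₂ a₃ a₄ b₁ b₂ b₃ c₂ : ℤ) →
  a₄ ≡ + 6 * a₃ - a₂ + b₃ → a₂ ≡ + 6 * a₁ - a₀ + b₁ → b₃ ≡ + 6 * b₂ - b₁ + c₂ →
  (+ 3 + n) * b₃ - (1ℤ + s) * (a₄ - a₂) ≡
    + 6 * ((+ 2 + n) * b₂ - (1ℤ + s) * (a₃ - a₁)) + -1ℤ * ((1ℤ + n) * b₁ - (1ℤ + s) * (a₂ - a₀))
    + ((+ 2 + n) * c₂ - s * (b₃ - b₁))
defect-algebra s n a₀ a₁ _ a₃ _ b₁ b₂ _ c₂ refl refl refl =
  solve (s ∷ n ∷ a₀ ∷ a₁ ∷ a₃ ∷ b₁ ∷ b₂ ∷ c₂ ∷ [])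

defect-recurrence : ∀ r n →
  derivative-defect (suc r) (suc (suc n)) ≡
    + 6 * derivative-defect (suc r) (suc n) + -1ℤ * derivative-defect (suc r) n
    + derivative-defect r (suc n)
defect-recurrence r n =
  defect-algebra (+ r) (+ n) (a 0) (a 1) (a 2) (a 3) (a 4) (b 1) (b 2) (b 3) (c 2)
    (conv-recurrence (suc r) (suc (suc n))) (conv-recurrence (suc r) n) (conv-recurrence r (suc n))
  where
  a b c : ℕ → ℤ
  a j = conv (suc (suc r)) (j ℕ.+ n)
  b j = conv (suc r) (j ℕ.+ n)
  c j = conv r (j ℕ.+ n)

-- In the initial cases every convolution value inside a defect computes to 0,
-- leaving a defect of the shape u·0 − v·0.
zero-difference : ∀ (u v : ℤ) → u * 0ℤ - v * 0ℤ ≡ 0ℤ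
zero-difference = solve-∀

derivative-defect-vanishes : ∀ r n → derivative-defect r n ≡ 0ℤ
derivative-defect-vanishes zero    n = zero-difference (+ suc n) (+ 0)
derivative-defect-vanishes (suc r) =
  forced-recurrence-vanishes (+ 6) -1ℤ (derivative-defect (suc r)) (λ n → derivative-defect r (suc n))
    (defect-recurrence r) (λ n → derivative-defect-vanishes r (suc n)) (initial₀ r) (initial₁ r)
  where
  initial₀ : ∀ r → derivative-defect (suc r) 0 ≡ 0ℤ
  initial₀ zero    = refl
  initial₀ (suc r) = zero-difference 1ℤ (+ suc (suc r))
  initial₁ : ∀ r → derivative-defect (suc r) 1 ≡ 0ℤ
  initial₁ zero          = refl
  initial₁ (suc zero)    = refl
  initial₁ (suc (suc r)) = zero-difference (+ 2) (+ suc (suc (suc r)))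

-- (Bʳ)' = r·Bʳ⁺¹(x⁻² − 1), coefficientwise.
derivative-identity : ∀ r n → + suc n * conv r (suc n) ≡ + r * Δ₂ (conv (suc r)) n
derivative-identity r n = ℤP.i-j≡0⇒i≡j _ _ (derivative-defect-vanishes r n)

weighted : ℕ → ℕ → ℤ
weighted c e = + (c ℕ.* e) * B e

weighted-zero : ∀ c → weighted c 0 ≡ 0ℤ
weighted-zero c = ℤP.*-zeroʳ (+ (c ℕ.* 0))

weighted-split : ∀ c e → weighted c e ≡ + c * (+ e * B e)
weighted-split c e = trans (cong (_* B e) (ℤP.pos-* c e)) (ℤP.*-assoc (+ c) (+ e) (B e))

weighted-linear : ∀ K N c₁ c₂ c₃ e → (0 < e → K ℕ.* c₁ ≡ K ℕ.* c₂ ℕ.+ N ℕ.* c₃) →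
  + K * weighted c₁ e ≡ + K * weighted c₂ e + + N * weighted c₃ e
weighted-linear K N c₁ c₂ c₃ zero relation
  rewrite weighted-zero c₁ | weighted-zero c₂ | weighted-zero c₃ = absorb-zero (+ K) (+ N)
  where
  absorb-zero : ∀ u v → u * 0ℤ ≡ u * 0ℤ + v * 0ℤ
  absorb-zero = solve-∀
weighted-linear K N c₁ c₂ c₃ e@(suc _) relation = begin
  + K * weighted c₁ e                     ≡⟨ cong (+ K *_) (weighted-split c₁ e) ⟩
  + K * (+ c₁ * v)                        ≡⟨ sym (ℤP.*-assoc (+ K) (+ c₁) v) ⟩
  + K * + c₁ * v                          ≡⟨ cong (_* v) relation-ℤ ⟩
  (+ K * + c₂ + + N * + c₃) * v           ≡⟨ distribute (+ K) (+ c₂) (+ N) (+ c₃) v ⟩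
  + K * (+ c₂ * v) + + N * (+ c₃ * v)
    ≡⟨ sym (cong₂ (λ x y → + K * x + + N * y) (weighted-split c₂ e) (weighted-split c₃ e)) ⟩
  + K * weighted c₂ e + + N * weighted c₃ e ∎
  where
  v = + e * B e
  relation-ℤ : + K * + c₁ ≡ + K * + c₂ + + N * + c₃
  relation-ℤ = begin
    + K * + c₁                        ≡⟨ sym (ℤP.pos-* K c₁) ⟩
    + (K ℕ.* c₁)                      ≡⟨ cong +_ (relation (s≤s z≤n)) ⟩
    + (K ℕ.* c₂ ℕ.+ N ℕ.* c₃)         ≡⟨ ℤP.pos-+ (K ℕ.* c₂) (N ℕ.* c₃) ⟩
    + (K ℕ.* c₂) + + (N ℕ.* c₃)       ≡⟨ cong₂ _+_ (ℤP.pos-* K c₂) (ℤP.pos-* N c₃) ⟩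
    + K * + c₂ + + N * + c₃ ∎
  distribute : ∀ a b c d v → (a * b + c * d) * v ≡ a * (b * v) + c * (d * v)
  distribute = solve-∀

-- (k+1) times the m-th summand of the right-hand side for r = k + 2:
--   C(n−m−1, k)·C(m+k, k)·e·B_e  with  e = n − 2m − (k+1).
coefficient : ℕ → ℕ → ℕ → ℕ
coefficient k n m = ((n ∸ m ∸ 1) C k) ℕ.* ((m ℕ.+ k) C k)

term : ℕ → ℕ → ℕ → ℤ
term k n m = weighted (coefficient k n m) (n ∸ 2 ℕ.* m ∸ suc k)

T : ℕ → ℕ → ℤ
T k n = ∑ n (term k n)

term-vanishes : ∀ k n m → n ∸ suc k ≤ 2 ℕ.* m → term k n m ≡ 0ℤ
term-vanishes k n m bound =
  trans (cong (weighted (coefficient k n m)) (exponent-zero n m k bound)) (weighted-zero (coefficient k n m))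

term-vanishes-beyond : ∀ k n m → n ≤ m → term k n m ≡ 0ℤ
term-vanishes-beyond k n m n≤m = term-vanishes k n m (beyond-range n m k n≤m)

-- The summand term (k+1) n m, re-indexed by m + 1 and completed by a zero term at m = 0.
shifted-coefficient : ℕ → ℕ → ℕ → ℕ
shifted-coefficient k n m = ((n ∸ m) C suc k) ℕ.* ((m ℕ.+ k) C suc k)

shifted : ℕ → ℕ → ℕ → ℤ
shifted k n m = weighted (shifted-coefficient k n m) (n ∸ 2 ℕ.* m ∸ k)

shifted-zero : ∀ k n → shifted k n 0 ≡ 0ℤ
shifted-zero k n =
  cong (λ c → weighted c (n ∸ 0 ∸ k))
       (trans (cong ((n C suc k) ℕ.*_) (k>n⇒nCk≡0 {k} {suc k} (ℕP.n<1+n k))) (ℕP.*-zeroʳ (n C suc k)))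

shifted-suc : ∀ k n m → shifted k n (suc m) ≡ term (suc k) n m
shifted-suc k n m = cong₂ weighted
  (cong₂ (λ x y → (x C suc k) ℕ.* (y C suc k)) (sym first) (sym (ℕP.+-suc m k)))
  (sym exponent)
  where
  first : n ∸ m ∸ 1 ≡ n ∸ suc m
  first = trans (ℕP.∸-+-assoc n m 1) (cong (n ∸_) (ℕP.+-comm m 1))
  exponent : n ∸ 2 ℕ.* m ∸ suc (suc k) ≡ n ∸ 2 ℕ.* suc m ∸ k
  exponent = begin
    n ∸ 2 ℕ.* m ∸ suc (suc k)      ≡⟨ ℕP.∸-+-assoc n (2 ℕ.* m) (suc (suc k)) ⟩
    n ∸ (2 ℕ.* m ℕ.+ suc (suc k))  ≡⟨ cong (n ∸_) (reindex m k) ⟩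
    n ∸ (2 ℕ.* suc m ℕ.+ k)        ≡⟨ sym (ℕP.∸-+-assoc n (2 ℕ.* suc m) k) ⟩
    n ∸ 2 ℕ.* suc m ∸ k ∎
    where
    reindex : ∀ m k → 2 ℕ.* m ℕ.+ suc (suc k) ≡ 2 ℕ.* suc m ℕ.+ k
    reindex = ℕSolver.solve-∀

term-step : ∀ k n m →
  + suc k * term (suc k) (suc (suc n)) m ≡ + suc k * shifted k n m + + suc n * term k (suc n) m
term-step k n m
  rewrite ∸-suc-suc (suc n) (2 ℕ.* m) (suc k) | ∸-suc-suc n (2 ℕ.* m) k =
  weighted-linear (suc k) (suc n)
    (coefficient (suc k) (suc (suc n)) m) (shifted-coefficient k n m) (coefficient k (suc n) m)
    (n ∸ 2 ℕ.* m ∸ k)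
    (λ pos → coefficient-step k n m (positive-exponent⇒m≤n n m k pos))

T-recurrence : ∀ k n →
  + suc k * T (suc k) (suc (suc n)) ≡ + suc k * T (suc k) n + + suc n * T k (suc n)
T-recurrence k n = begin
  + suc k * ∑ (suc (suc n)) (term (suc k) (suc (suc n)))
    ≡⟨ sym (∑-scale (suc (suc n)) (+ suc k) (term (suc k) (suc (suc n)))) ⟩
  ∑ (suc (suc n)) (λ m → + suc k * term (suc k) (suc (suc n)) m)
    ≡⟨ ∑-cong (suc (suc n)) (term-step k n) ⟩
  ∑ (suc (suc n)) (λ m → + suc k * shifted k n m + + suc n * term k (suc n) m)
    ≡⟨ ∑-linear (suc (suc n)) (+ suc k) (+ suc n) (shifted k n) (term k (suc n)) ⟩
  + suc k * ∑ (suc (suc n)) (shifted k n) + + suc n * ∑ (suc (suc n)) (term k (suc n))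
    ≡⟨ cong₂ (λ x y → + suc k * x + + suc n * y) shifted-sum
             (∑-truncate (suc n) 1 (term k (suc n)) (term-vanishes-beyond k (suc n))) ⟩
  + suc k * T (suc k) n + + suc n * T k (suc n) ∎
  where
  shifted-sum : ∑ (suc (suc n)) (shifted k n) ≡ T (suc k) n
  shifted-sum = begin
    shifted k n 0 + ∑ (suc n) (λ m → shifted k n (suc m))
      ≡⟨ cong₂ _+_ (shifted-zero k n) (∑-cong (suc n) (shifted-suc k n)) ⟩
    0ℤ + ∑ (suc n) (term (suc k) n)
      ≡⟨ ℤP.+-identityˡ _ ⟩
    ∑ (suc n) (term (suc k) n)
      ≡⟨ ∑-truncate n 1 (term (suc k) n) (term-vanishes-beyond (suc k) n) ⟩
    T (suc k) n ∎

-- For k = 0 all coefficients are 1 and the recurrence reads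
-- T 0 (n+2) = (n+1)·B (n+1) + T 0 n.
T-recurrence-zero : ∀ n → T 0 (suc (suc n)) ≡ + suc n * B (suc n) + T 0 n
T-recurrence-zero n = cong₂ _+_ leading (begin
  ∑ (suc n) (λ m → term 0 (suc (suc n)) (suc m)) ≡⟨ ∑-cong (suc n) shift ⟩
  ∑ (suc n) (term 0 n)                            ≡⟨ ∑-truncate n 1 (term 0 n) (term-vanishes-beyond 0 n) ⟩
  T 0 n ∎)
  where
  leading : term 0 (suc (suc n)) 0 ≡ + suc n * B (suc n)
  leading = cong (λ c → + c * B (suc n)) (ℕP.*-identityˡ (suc n))
  shift : ∀ m → term 0 (suc (suc n)) (suc m) ≡ term 0 n m
  shift m = cong (λ e → weighted 1 (e ∸ 1)) (cong (suc n ∸_) (ℕP.+-suc m (m ℕ.+ 0)))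

T-Δ₂-zero : ∀ n → Δ₂ (T 0) n ≡ + suc n * B (suc n)
T-Δ₂-zero n = trans (cong (_- T 0 n) (T-recurrence-zero n)) (cancel (+ suc n * B (suc n)) (T 0 n))
  where
  cancel : ∀ a b → a + b - b ≡ a
  cancel = solve-∀

T-Δ₂ : ∀ k n → + suc k * Δ₂ (T (suc k)) n ≡ + suc n * T k (suc n)
T-Δ₂ k n = begin
  + suc k * Δ₂ (T (suc k)) n
    ≡⟨ sym (Δ₂-scale (+ suc k) (T (suc k)) n) ⟩
  + suc k * T (suc k) (suc (suc n)) - + suc k * T (suc k) n
    ≡⟨ cong (_- + suc k * T (suc k) n) (T-recurrence k n) ⟩
  + suc k * T (suc k) n + + suc n * T k (suc n) - + suc k * T (suc k) n
    ≡⟨ cancel (+ suc k * T (suc k) n) (+ suc n * T k (suc n)) ⟩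
  + suc n * T k (suc n) ∎
  where
  cancel : ∀ a b → a + b - a ≡ b
  cancel = solve-∀

-- The main identity: (k+1)·conv (k+2) n = T k n.  Both sides have the same
-- initial values and, by derivative-identity and T-Δ₂ (with induction on k),
-- the same second differences.
closed-form : ∀ k n → + suc k * conv (suc (suc k)) n ≡ T k n
closed-form zero = Δ₂-determines (λ n → 1ℤ * conv 2 n) (T 0) refl refl differences
  where
  differences : ∀ n → Δ₂ (λ n → 1ℤ * conv 2 n) n ≡ Δ₂ (T 0) n
  differences n = begin
    Δ₂ (λ n → 1ℤ * conv 2 n) n ≡⟨ Δ₂-scale 1ℤ (conv 2) n ⟩
    1ℤ * Δ₂ (conv 2) n         ≡⟨ sym (derivative-identity 1 n) ⟩
    + suc n * conv 1 (suc n)   ≡⟨ cong (+ suc n *_) (conv-one (suc n)) ⟩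
    + suc n * B (suc n)        ≡⟨ sym (T-Δ₂-zero n) ⟩
    Δ₂ (T 0) n ∎
closed-form (suc k) = Δ₂-determines x (T (suc k)) initial₀ initial₁ differences
  where
  x : ℕ → ℤ
  x n = + suc (suc k) * conv (suc (suc (suc k))) n
  initial₀ : x 0 ≡ T (suc k) 0
  initial₀ = ℤP.*-zeroʳ (+ suc (suc k))
  initial₁ : x 1 ≡ T (suc k) 1
  initial₁ = trans (ℤP.*-zeroʳ (+ suc (suc k)))
                   (sym (trans (ℤP.+-identityʳ (term (suc k) 1 0)) (weighted-zero (coefficient (suc k) 1 0))))
  differences : ∀ n → Δ₂ x n ≡ Δ₂ (T (suc k)) n
  differences n = ℤP.*-cancelˡ-≡ (+ suc k) (Δ₂ x n) (Δ₂ (T (suc k)) n) (begin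
    + suc k * Δ₂ x n
      ≡⟨ cong (+ suc k *_) (Δ₂-scale (+ suc (suc k)) (conv (suc (suc (suc k)))) n) ⟩
    + suc k * (+ suc (suc k) * Δ₂ (conv (suc (suc (suc k)))) n)
      ≡⟨ cong (+ suc k *_) (sym (derivative-identity (suc (suc k)) n)) ⟩
    + suc k * (+ suc n * conv (suc (suc k)) (suc n))
      ≡⟨ swap (+ suc k) (+ suc n) (conv (suc (suc k)) (suc n)) ⟩
    + suc n * (+ suc k * conv (suc (suc k)) (suc n))
      ≡⟨ cong (+ suc n *_) (closed-form k (suc n)) ⟩
    + suc n * T k (suc n)
      ≡⟨ sym (T-Δ₂ k n) ⟩
    + suc k * Δ₂ (T (suc k)) n ∎)
    where
    swap : ∀ a b c → a * (b * c) ≡ b * (a * c)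
    swap = solve-∀

T-cutoff : ∀ k n → T k n ≡ ∑ (suc ((n ∸ suc k) ℕ./ 2)) (term k n)
T-cutoff k n = ∑-support n (suc ((n ∸ suc k) ℕ./ 2)) (term k n)
  (term-vanishes-beyond k n)
  (λ m b≤m → term-vanishes k n m (beyond-half n m k b≤m))

/-+-common : ∀ (a b : ℤ) d → a ℚ./ suc d ℚ.+ b ℚ./ suc d ≡ (a + b) ℚ./ suc d
/-+-common a b d = ℚP.toℚᵘ-injective
  (ℚᵘP.≃-trans (ℚP.toℚᵘ-homo-+ (a ℚ./ suc d) (b ℚ./ suc d))
  (ℚᵘP.≃-trans (ℚᵘP.+-cong (ℚP.toℚᵘ-fromℚᵘ (ℚᵘ.mkℚᵘ a d)) (ℚP.toℚᵘ-fromℚᵘ (ℚᵘ.mkℚᵘ b d)))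
  (ℚᵘP.≃-trans (ℚᵘ.*≡* cross-multiplied)
               (ℚᵘP.≃-sym (ℚP.toℚᵘ-fromℚᵘ (ℚᵘ.mkℚᵘ (a + b) d))))))
  where
  cross-multiplied : (a * + suc d + b * + suc d) * + suc d ≡ (a + b) * + (suc d ℕ.* suc d)
  cross-multiplied = trans (factor a b (+ suc d)) (cong ((a + b) *_) (sym (ℤP.pos-* (suc d) (suc d))))
    where
    factor : ∀ a b D → (a * D + b * D) * D ≡ (a + b) * (D * D)
    factor = solve-∀

sumℚ-/ : ∀ d (f : ℕ → ℤ) xs → sumℚ (map (λ m → f m ℚ./ suc d) xs) ≡ sumℤ (map f xs) ℚ./ suc d
sumℚ-/ d f []       = sym (ℚP.0/n≡0 (suc d))
sumℚ-/ d f (x ∷ xs) = trans (cong (λ q → f x ℚ./ suc d ℚ.+ q) (sumℚ-/ d f xs)) (/-+-common (f x) _ d)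

scale-/ : ∀ (a : ℤ) k → a ℚ./ 1 ≡ (+ suc k * a) ℚ./ suc k
scale-/ a k =
  ℚP.fromℚᵘ-cong {ℚᵘ.mkℚᵘ a 0} {ℚᵘ.mkℚᵘ (+ suc k * a) k} (ℚᵘ.*≡* (commute a (+ suc k)))
  where
  commute : ∀ a K → a * K ≡ (K * a) * 1ℤ
  commute = solve-∀

theorem5 : (n r : ℕ) → 2 ≤ r → r ≤ n →
    (lhs r n ℚ./ 1) ≡ rhs r n
theorem5 n (suc (suc k)) (s≤s (s≤s _)) _ = begin
  lhs r n ℚ./ 1                               ≡⟨ scale-/ (lhs r n) k ⟩
  (+ suc k * lhs r n) ℚ./ suc k               ≡⟨ cong (λ z → (+ suc k * z) ℚ./ suc k) (lhs≡conv r n) ⟩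
  (+ suc k * conv r n) ℚ./ suc k              ≡⟨ cong (ℚ._/ suc k) (closed-form k n) ⟩
  T k n ℚ./ suc k                             ≡⟨ cong (ℚ._/ suc k) (T-cutoff k n) ⟩
  ∑ cutoff (term k n) ℚ./ suc k               ≡⟨ cong (ℚ._/ suc k) (sym (sumℤ-upTo (term k n) cutoff)) ⟩
  sumℤ (map (term k n) (upTo cutoff)) ℚ./ suc k ≡⟨ sym (sumℚ-/ k (term k n) (upTo cutoff)) ⟩
  rhs r n ∎
  where
  r = suc (suc k)
  cutoff = suc ((n ∸ suc k) ℕ./ 2)
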